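{- Let $G_1,\dots,G_n$ be groups ($n\ge 2$) and let $G$ be a subgroup of $G_1\times\dots\times G_n$ such that each projection $\pi_i:G\to G_i$ is surjective. Then $G$ is a normal subgroup of $G_1\times\dots\times G_n$ if and only if $G$ has abelian entanglements with respect to $G_1\times\dots\times G_n$.
   Context: For a nonempty $S\subseteq\{1,\dots,n\}$ let $\pi_S:G_1\times\dots\times G_n\to\prod_{i\in S}G_i$ be the projection and $G_S=\pi_S(G)$. For a partition $\{S,T\}$ of $\{1,\dots,n\}$ into two nonempty sets, $G$ is a subgroup of $G_S\times G_T$ with surjective projections; its Goursat quotient is $Q_{\{S,T\}}:=G_S/\pi_S\big(G\cap(G_S\times\{1\})\big)$ (here $\pi_S(G\cap(G_S\times\{1\}))$ is normal in $G_S$ and $Q_{\{S,T\}}$ is isomorphic to the analogous quotient of $G_T$). $G$ is said to have abelian entanglements with respect to $G_1\times\dots\times G_n$ if $Q_{\{S,T\}}$ is abelian for every such two-set partition $\{S,T\}$. -}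

module Defs where

open import Level using (Level; _⊔_)
open import Data.Nat using (ℕ)
open import Data.Fin using (Fin)
open import Data.Fin.Subset using (Subset; _∈_; ∁; Nonempty)
open import Data.Product using (Σ; ∃; _×_; _,_)
open import Algebra.Bundles using (Group)

module _ {c ℓ : Level} {n : ℕ} (G : Fin n → Group c ℓ) where
  open Group

  Elt : Set c
  Elt = (i : Fin n) → Carrier (G i)

  _≈ᴾ_ : Elt → Elt → Set ℓ
  g ≈ᴾ h = ∀ i → _≈_ (G i) (g i) (h i)

  _∙ᴾ_ : Elt → Elt → Elt
  (g ∙ᴾ h) i = _∙_ (G i) (g i) (h i)

  εᴾ : Elt
  εᴾ i = ε (G i)

  _⁻¹ᴾ : Elt → Elt
  (g ⁻¹ᴾ) i = _⁻¹ (G i) (g i)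

  record Subgroup (p : Level) : Set (c ⊔ ℓ ⊔ Level.suc p) where
    field
      Mem     : Elt → Set p
      Mem-resp : ∀ {g h} → g ≈ᴾ h → Mem g → Mem h
      Mem-ε   : Mem εᴾ
      Mem-∙   : ∀ {g h} → Mem g → Mem h → Mem (g ∙ᴾ h)
      Mem-⁻¹  : ∀ {g} → Mem g → Mem (g ⁻¹ᴾ)

  module _ {p : Level} (H : Subgroup p) where
    open Subgroup H

    SurjectiveProjections : Set (c ⊔ ℓ ⊔ p)
    SurjectiveProjections =
      ∀ (i : Fin n) (x : Carrier (G i)) → ∃ λ g → Mem g × _≈_ (G i) (g i) x

    IsNormal : Set (c ⊔ p)
    IsNormal = ∀ (g h : Elt) → Mem h → Mem ((g ∙ᴾ h) ∙ᴾ (g ⁻¹ᴾ))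

    EltOn : Subset n → Set c
    EltOn S = (i : Fin n) → i ∈ S → Carrier (G i)

    module _ (S : Subset n) where
      _≈ˢ_ : EltOn S → EltOn S → Set ℓ
      x ≈ˢ y = ∀ i (i∈S : i ∈ S) → _≈_ (G i) (x i i∈S) (y i i∈S)

      _∙ˢ_ : EltOn S → EltOn S → EltOn S
      (x ∙ˢ y) i i∈S = _∙_ (G i) (x i i∈S) (y i i∈S)

      _⁻¹ˢ : EltOn S → EltOn S
      (x ⁻¹ˢ) i i∈S = _⁻¹ (G i) (x i i∈S)

      π : Elt → EltOn S
      π g i _ = g i

      InG : EltOn S → Set (c ⊔ ℓ ⊔ p)
      InG x = ∃ λ g → Mem g × π g ≈ˢ x

      InN : EltOn S → Set (c ⊔ ℓ ⊔ p)
      InN x = ∃ λ g → Mem g × (∀ i → i ∈ ∁ S → _≈_ (G i) (g i) (ε (G i))) × π g ≈ˢ x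

      -- The Goursat quotient Q_{S,T} = G_S / N_S is abelian: for x, y ∈ G_S,
      -- the classes of x∙y and y∙x agree, i.e. (x∙y)(y∙x)⁻¹ ∈ N_S.
      QuotientAbelian : Set (c ⊔ ℓ ⊔ p)
      QuotientAbelian = ∀ (x y : EltOn S) → InG x → InG y →
        InN ((x ∙ˢ y) ∙ˢ ((y ∙ˢ x) ⁻¹ˢ))

    AbelianEntanglements : Set (c ⊔ ℓ ⊔ p)
    AbelianEntanglements =
      ∀ (S : Subset n) → Nonempty S → Nonempty (∁ S) → QuotientAbelian S

module Submission where

-- Write conj a h = a h a⁻¹ and commutator x y = (x y)(y x)⁻¹ = x y x⁻¹ y⁻¹.
--
-- (⇒) If H is normal and x = π_S g, y = π_S h with g, h ∈ H, let a be h with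
--     its coordinates outside S replaced by 1.  Then g · conj a g⁻¹ lies in H,
--     is trivial outside S, and equals commutator x y on S; so Q_{S,T} is
--     abelian.  This works for every S.
-- (⇐) The elements g with g H g⁻¹ ⊆ H (the normalizer of H) form a subgroup.
--     If g is supported at one coordinate j, pick k ∈ H with k_j = g_j
--     (surjectivity of π_j); abelianness of Q_{{j},T} applied to h⁻¹ and k
--     gives m ∈ H, trivial off j, with m_j = commutator h_j⁻¹ k_j, and then
--     conj g h = h · m ∈ H.  Every element of G₁ × ⋯ × Gₙ is a product of
--     single-coordinate elements, so the normalizer is everything.
--     Here n ≥ 2 guarantees that the partitions {{j}, ∁{j}} are admissible.

open import Defs
open import Level using (Level; _⊔_)
open import Data.Nat using (ℕ; _≤_)
open import Data.Fin using (Fin)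
open import Algebra.Bundles using (Group)
open import Function.Bundles using (_⇔_)

open import Data.Nat as ℕ using (zero; suc; s≤s; z≤n; _<_)
import Data.Nat.Properties as ℕₚ
open import Data.Fin as Fin using (toℕ; fromℕ<; punchIn)
import Data.Fin.Properties as Finₚ
open import Data.Fin.Subset using (_∈_; ⁅_⁆; ∁; Nonempty)
open import Data.Fin.Subset.Properties using (_∈?_; x∈⁅x⁆; x≢y⇒x∉⁅y⁆; x∉p⇒x∈∁p; x∈∁p⇒x∉p)
open import Data.Product using (_,_)
open import Data.Sum using (inj₁; inj₂)
open import Function.Bundles using (mk⇔)
open import Relation.Nullary using (yes; no; ¬_)
open import Relation.Nullary.Negation using (contradiction)
open import Relation.Unary using (Pred; Decidable)
open import Relation.Binary.PropositionalEquality as ≡ using (_≡_; _≢_)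
import Algebra.Properties.Group as GroupProperties
import Relation.Binary.Reasoning.Setoid as SetoidReasoning

module Conjugation {c ℓ : Level} (K : Group c ℓ) where
  open Group K
  open GroupProperties K
  open SetoidReasoning setoid

  conj : Carrier → Carrier → Carrier
  conj a h = (a ∙ h) ∙ a ⁻¹

  commutator : Carrier → Carrier → Carrier
  commutator x y = (x ∙ y) ∙ (y ∙ x) ⁻¹

  conj-cong : ∀ {a a′ h h′} → a ≈ a′ → h ≈ h′ → conj a h ≈ conj a′ h′
  conj-cong a≈a′ h≈h′ = ∙-cong (∙-cong a≈a′ h≈h′) (⁻¹-cong a≈a′)

  commutator-cong : ∀ {x x′ y y′} → x ≈ x′ → y ≈ y′ → commutator x y ≈ commutator x′ y′
  commutator-cong x≈x′ y≈y′ = ∙-cong (∙-cong x≈x′ y≈y′) (⁻¹-cong (∙-cong y≈y′ x≈x′))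

  conj-by-ε : ∀ h → conj ε h ≈ h
  conj-by-ε h = trans (∙-cong (identityˡ h) ε⁻¹≈ε) (identityʳ h)

  conj-∙ : ∀ a b h → conj a (conj b h) ≈ conj (a ∙ b) h
  conj-∙ a b h = begin
    (a ∙ ((b ∙ h) ∙ b ⁻¹)) ∙ a ⁻¹ ≈⟨ ∙-congʳ (assoc a _ _) ⟨
    ((a ∙ (b ∙ h)) ∙ b ⁻¹) ∙ a ⁻¹ ≈⟨ ∙-congʳ (∙-congʳ (assoc a b h)) ⟨
    (((a ∙ b) ∙ h) ∙ b ⁻¹) ∙ a ⁻¹ ≈⟨ assoc _ _ _ ⟩
    ((a ∙ b) ∙ h) ∙ (b ⁻¹ ∙ a ⁻¹) ≈⟨ ∙-congˡ (⁻¹-anti-homo-∙ a b) ⟨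
    ((a ∙ b) ∙ h) ∙ (a ∙ b) ⁻¹    ∎

  commutator-as-product : ∀ x y → x ∙ conj y (x ⁻¹) ≈ commutator x y
  commutator-as-product x y = begin
    x ∙ ((y ∙ x ⁻¹) ∙ y ⁻¹) ≈⟨ ∙-congˡ (assoc y (x ⁻¹) (y ⁻¹)) ⟩
    x ∙ (y ∙ (x ⁻¹ ∙ y ⁻¹)) ≈⟨ assoc x y _ ⟨
    (x ∙ y) ∙ (x ⁻¹ ∙ y ⁻¹) ≈⟨ ∙-congˡ (⁻¹-anti-homo-∙ y x) ⟨
    (x ∙ y) ∙ (y ∙ x) ⁻¹    ∎

  conj-as-product : ∀ x h → conj x h ≈ h ∙ commutator (h ⁻¹) x
  conj-as-product x h = sym (begin
    h ∙ ((h ⁻¹ ∙ x) ∙ (x ∙ h ⁻¹) ⁻¹) ≈⟨ ∙-congˡ (∙-congˡ (⁻¹-anti-homo-∙ x (h ⁻¹))) ⟩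
    h ∙ ((h ⁻¹ ∙ x) ∙ (h ⁻¹ ⁻¹ ∙ x ⁻¹)) ≈⟨ ∙-congˡ (∙-congˡ (∙-congʳ (⁻¹-involutive h))) ⟩
    h ∙ ((h ⁻¹ ∙ x) ∙ (h ∙ x ⁻¹))    ≈⟨ assoc h _ _ ⟨
    (h ∙ (h ⁻¹ ∙ x)) ∙ (h ∙ x ⁻¹)    ≈⟨ ∙-congʳ (assoc h (h ⁻¹) x) ⟨
    ((h ∙ h ⁻¹) ∙ x) ∙ (h ∙ x ⁻¹)    ≈⟨ ∙-congʳ (trans (∙-congʳ (inverseʳ h)) (identityˡ x)) ⟩
    x ∙ (h ∙ x ⁻¹)                  ≈⟨ assoc x h (x ⁻¹) ⟨
    (x ∙ h) ∙ x ⁻¹                  ∎)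

module Coordinates {c ℓ : Level} {n : ℕ} (G : Fin n → Group c ℓ) where
  open Group using (_≈_; ε)
  module Gᵢ (i : Fin n) = Group (G i)

  SupportedAt : Fin n → Elt G → Set ℓ
  SupportedAt j g = ∀ i → i ≢ j → _≈_ (G i) (g i) (ε (G i))

  restrict : ∀ {r} {P : Pred (Fin n) r} → Decidable P → Elt G → Elt G
  restrict P? g i with P? i
  ... | yes _ = g i
  ... | no _  = ε (G i)

  restrict-∈ : ∀ {r} {P : Pred (Fin n) r} (P? : Decidable P) g i →
               P i → _≈_ (G i) (restrict P? g i) (g i)
  restrict-∈ P? g i Pi with P? i
  ... | yes _  = Gᵢ.refl i
  ... | no ¬Pi = contradiction Pi ¬Pi

  restrict-∉ : ∀ {r} {P : Pred (Fin n) r} (P? : Decidable P) g i →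
               ¬ P i → _≈_ (G i) (restrict P? g i) (ε (G i))
  restrict-∉ P? g i ¬Pi with P? i
  ... | yes Pi = contradiction Pi ¬Pi
  ... | no _   = Gᵢ.refl i

  hasIndex? : ∀ m → Decidable (λ (i : Fin n) → toℕ i ≡ m)
  hasIndex? m i = toℕ i ℕ.≟ m

  atIndex : Elt G → ℕ → Elt G
  atIndex g m = restrict (hasIndex? m) g

  atIndex-supported : ∀ g {m} (m<n : m < n) → SupportedAt (fromℕ< m<n) (atIndex g m)
  atIndex-supported g m<n i i≢j = restrict-∉ (hasIndex? _) g i λ i≡m →
    i≢j (Finₚ.toℕ-injective (≡.trans i≡m (≡.sym (Finₚ.toℕ-fromℕ< m<n))))

  prefix : Elt G → ℕ → Elt G
  prefix g zero    = εᴾ G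
  prefix g (suc m) = _∙ᴾ_ G (prefix g m) (atIndex g m)

  prefix-below : ∀ g m i → toℕ i < m → _≈_ (G i) (prefix g m i) (g i)
  prefix-above : ∀ g m i → m ≤ toℕ i → _≈_ (G i) (prefix g m i) (ε (G i))

  prefix-below g (suc m) i i<1+m with ℕₚ.m≤n⇒m<n∨m≡n (ℕₚ.≤-pred i<1+m)
  ... | inj₁ i<m = Gᵢ.trans i
    (Gᵢ.∙-cong i (prefix-below g m i i<m) (restrict-∉ (hasIndex? m) g i (ℕₚ.<⇒≢ i<m)))
    (Gᵢ.identityʳ i (g i))
  ... | inj₂ i≡m = Gᵢ.trans i
    (Gᵢ.∙-cong i (prefix-above g m i (ℕₚ.≤-reflexive (≡.sym i≡m))) (restrict-∈ (hasIndex? m) g i i≡m))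
    (Gᵢ.identityˡ i (g i))
  prefix-above g zero i _ = Gᵢ.refl i
  prefix-above g (suc m) i m<i = Gᵢ.trans i
    (Gᵢ.∙-cong i (prefix-above g m i (ℕₚ.<⇒≤ m<i))
                 (restrict-∉ (hasIndex? m) g i (λ i≡m → ℕₚ.<⇒≢ m<i (≡.sym i≡m))))
    (Gᵢ.identityˡ i (ε (G i)))

  coordinate-induction : ∀ {q} (Q : Elt G → Set q) →
    (∀ {a b} → _≈ᴾ_ G a b → Q a → Q b) → Q (εᴾ G) →
    (∀ {a b} → Q a → Q b → Q (_∙ᴾ_ G a b)) →
    (∀ j g → SupportedAt j g → Q g) → ∀ g → Q g
  coordinate-induction Q Q-resp Q-ε Q-∙ Q-single g =
    Q-resp (λ i → prefix-below g n i (Finₚ.toℕ<n i)) (Q-prefix n ℕₚ.≤-refl)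
    where
    Q-prefix : ∀ m → m ≤ n → Q (prefix g m)
    Q-prefix zero    _     = Q-ε
    Q-prefix (suc m) m<n = Q-∙ (Q-prefix m (ℕₚ.<⇒≤ m<n))
                               (Q-single _ (atIndex g m) (atIndex-supported g m<n))

singleton-complement-nonempty : ∀ {n} → 2 ≤ n → (j : Fin n) → Nonempty (∁ ⁅ j ⁆)
singleton-complement-nonempty (s≤s (s≤s z≤n)) j =
  punchIn j Fin.zero , x∉p⇒x∈∁p (x≢y⇒x∉⁅y⁆ (Finₚ.punchInᵢ≢i j Fin.zero))

module Entanglement {c ℓ p : Level} {n : ℕ} (G : Fin n → Group c ℓ) (H : Subgroup G p) where
  open Subgroup H
  open Group using (_≈_; ε; _⁻¹; _∙_)
  open Coordinates G
  module Cᵢ (i : Fin n) = Conjugation (G i)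

  normal⇒quotientAbelian : IsNormal G H → ∀ S → QuotientAbelian G H S
  normal⇒quotientAbelian normal S x y (g , g∈H , g≈x) (h , h∈H , h≈y) =
    k , Mem-∙ g∈H (normal a (_⁻¹ᴾ G g) (Mem-⁻¹ g∈H)) , trivial-off-S , commutator-on-S
    where
    a : Elt G
    a = restrict (_∈? S) h
    k : Elt G
    k i = _∙_ (G i) (g i) (Cᵢ.conj i (a i) (_⁻¹ (G i) (g i)))
    trivial-off-S : ∀ i → i ∈ ∁ S → _≈_ (G i) (k i) (ε (G i))
    trivial-off-S i i∉S = Gᵢ.trans i
      (Gᵢ.∙-congˡ i (Gᵢ.trans i (Cᵢ.conj-cong i (restrict-∉ (_∈? S) h i (x∈∁p⇒x∉p i∉S)) (Gᵢ.refl i))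
                                (Cᵢ.conj-by-ε i _)))
      (Gᵢ.inverseʳ i (g i))
    commutator-on-S : _≈ˢ_ G H S (π G H S k) (_∙ˢ_ G H S (_∙ˢ_ G H S x y) (_⁻¹ˢ G H S (_∙ˢ_ G H S y x)))
    commutator-on-S i i∈S = Gᵢ.trans i
      (Gᵢ.∙-cong i (g≈x i i∈S)
        (Cᵢ.conj-cong i (Gᵢ.trans i (restrict-∈ (_∈? S) h i i∈S) (h≈y i i∈S)) (Gᵢ.⁻¹-cong i (g≈x i i∈S))))
      (Cᵢ.commutator-as-product i (x i i∈S) (y i i∈S))

  Normalizes : Elt G → Set (c ⊔ p)
  Normalizes g = ∀ h → Mem h → Mem (_∙ᴾ_ G (_∙ᴾ_ G g h) (_⁻¹ᴾ G g))

  normalizes-resp : ∀ {a b} → _≈ᴾ_ G a b → Normalizes a → Normalizes b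
  normalizes-resp a≈b a-norm h h∈H =
    Mem-resp (λ i → Cᵢ.conj-cong i (a≈b i) (Gᵢ.refl i)) (a-norm h h∈H)

  normalizes-ε : Normalizes (εᴾ G)
  normalizes-ε h h∈H = Mem-resp (λ i → Gᵢ.sym i (Cᵢ.conj-by-ε i (h i))) h∈H

  normalizes-∙ : ∀ {a b} → Normalizes a → Normalizes b → Normalizes (_∙ᴾ_ G a b)
  normalizes-∙ {a} {b} a-norm b-norm h h∈H =
    Mem-resp (λ i → Cᵢ.conj-∙ i (a i) (b i) (h i)) (a-norm _ (b-norm h h∈H))

  supported⇒normalizes : SurjectiveProjections G H → ∀ j g → SupportedAt j g →
                         QuotientAbelian G H ⁅ j ⁆ → Normalizes g
  supported⇒normalizes surj j g g-supp abelian h h∈H with surj j (g j)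
  ... | k , k∈H , kⱼ≈gⱼ
    with abelian (π G H ⁅ j ⁆ (_⁻¹ᴾ G h)) (π G H ⁅ j ⁆ k)
                 (_⁻¹ᴾ G h , Mem-⁻¹ h∈H , λ i _ → Gᵢ.refl i) (k , k∈H , λ i _ → Gᵢ.refl i)
  ... | m , m∈H , m-off , m-on = Mem-resp (λ i → Gᵢ.sym i (conj≈h∙m i)) (Mem-∙ h∈H m∈H)
    where
    conj≈h∙m : ∀ i → _≈_ (G i) (Cᵢ.conj i (g i) (h i)) (_∙_ (G i) (h i) (m i))
    conj≈h∙m i with i Finₚ.≟ j
    ... | yes ≡.refl = begin
      Cᵢ.conj i (g i) (h i)                                    ≈⟨ Cᵢ.conj-as-product i (g i) (h i) ⟩
      _∙_ (G i) (h i) (Cᵢ.commutator i (_⁻¹ (G i) (h i)) (g i)) ≈⟨ Gᵢ.∙-congˡ i (Cᵢ.commutator-cong i (Gᵢ.refl i) kⱼ≈gⱼ) ⟨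
      _∙_ (G i) (h i) (Cᵢ.commutator i (_⁻¹ (G i) (h i)) (k i)) ≈⟨ Gᵢ.∙-congˡ i (m-on i (x∈⁅x⁆ i)) ⟨
      _∙_ (G i) (h i) (m i)                                    ∎
      where open SetoidReasoning (Gᵢ.setoid i)
    ... | no i≢j = begin
      Cᵢ.conj i (g i) (h i)     ≈⟨ Cᵢ.conj-cong i (g-supp i i≢j) (Gᵢ.refl i) ⟩
      Cᵢ.conj i (ε (G i)) (h i) ≈⟨ Cᵢ.conj-by-ε i (h i) ⟩
      h i                       ≈⟨ Gᵢ.identityʳ i (h i) ⟨
      _∙_ (G i) (h i) (ε (G i)) ≈⟨ Gᵢ.∙-congˡ i (m-off i (x∉p⇒x∈∁p (x≢y⇒x∉⁅y⁆ i≢j))) ⟨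
      _∙_ (G i) (h i) (m i)     ∎
      where open SetoidReasoning (Gᵢ.setoid i)

proposition2p3 : ∀ {c ℓ p : Level} (n : ℕ) → 2 ≤ n → (G : Fin n → Group c ℓ)
    → (H : Subgroup G p) → SurjectiveProjections G H
    → IsNormal G H ⇔ AbelianEntanglements G H
proposition2p3 n 2≤n G H surj = mk⇔ forward backward
  where
  open Entanglement G H
  open Coordinates G using (coordinate-induction)

  forward : IsNormal G H → AbelianEntanglements G H
  forward normal S _ _ = normal⇒quotientAbelian normal S

  backward : AbelianEntanglements G H → IsNormal G H
  backward entangled = coordinate-induction Normalizes normalizes-resp normalizes-ε normalizes-∙
    λ j g g-supp → supported⇒normalizes surj j g g-supp
                     (entangled ⁅ j ⁆ (j , x∈⁅x⁆ j) (singleton-complement-nonempty 2≤n j))
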